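{- Let $k\ge 2$ and let $\mathcal P=(\mathcal C,\mathcal A)$ be a palette that is not admitted by the $k$-star $S_k$. Let $D$ be the directed graph whose vertex set is $\mathcal C_1\cup\mathcal C_2$, the disjoint union of two copies of $\mathcal C$ (the copies of $a\in\mathcal C$ being denoted $a^1\in\mathcal C_1$ and $a^2\in\mathcal C_2$), with arcs defined as follows for each pair $(a,b)\in\mathcal C^2$: there is an arc from $a^1$ to $b^1$ if $(a,b)$ is $(2,3)$-good; there is an arc from $a^2$ to $b^2$ if $(a,b)$ is $(1,2)$-good; and there are arcs from $a^1$ to $b^2$ and from $b^2$ to $a^1$ if $(a,b)$ is $(1,3)$-good. Then $D$ does not contain a transitive tournament on $k$ vertices as a subgraph.
   Context: A palette $\mathcal P=(\mathcal C,\mathcal A)$ consists of a finite set $\mathcal C$ of colors and a set $\mathcal A\subseteq\mathcal C^3$ of ordered triples. For colors $a,b$ and distinct $i,j\in\{1,2,3\}$, $(a,b)$ is $(i,j)$-good if some $(c_1,c_2,c_3)\in\mathcal A$ has $c_i=a$ and $c_j=b$. A $3$-graph $F$ admits $\mathcal P$ if there is a linear order $\preceq$ on $V(F)$ and a map $\varphi:\binom{V(F)}{2}\to\mathcal C$ such that for every edge $\{x,y,z\}$ of $F$ with $x\prec y\prec z$ we have $(\varphi(xy),\varphi(xz),\varphi(yz))\in\mathcal A$. The $k$-star $S_k$ is the $3$-graph on vertices $u,v_1,\dots,v_k$ with edges $\{u,v_i,v_j\}$ for $1\le i<j\le k$. A transitive tournament on $k$ vertices in a digraph is a set of $k$ distinct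 vertices $x_1,\dots,x_k$ such that the arc from $x_i$ to $x_j$ is present for all $i<j$. -}

module Defs where

open import Data.Nat using (ℕ; suc; _<_)
open import Data.Fin using (Fin; zero; suc) renaming (_<_ to _<ᶠ_)
open import Data.Product using (Σ; ∃; _×_; _,_)
open import Data.Sum using (_⊎_; inj₁; inj₂)
open import Relation.Binary.PropositionalEquality using (_≡_; _≢_)
open import Function.Definitions using (Injective)
open import Level using (0ℓ) renaming (suc to lsuc)

record Palette : Set₁ where
  field
    c : ℕ
    A : Fin c → Fin c → Fin c → Set

open Palette public

-- A 3-graph on vertex set Fin n, given by a predicate on vertex triples;
-- an edge {x,y,z} is recorded as  IsEdge x y z  (the predicate is meant
-- to hold for all orderings of an edge; S_k below satisfies this).
record ThreeGraph : Set₁ where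
  field
    n : ℕ
    IsEdge : Fin n → Fin n → Fin n → Set

open ThreeGraph public

Good12 Good13 Good23 : (P : Palette) → Fin (c P) → Fin (c P) → Set
Good12 P a b = ∃ λ z → A P a b z
Good13 P a b = ∃ λ y → A P a y b
Good23 P a b = ∃ λ x → A P x a b

-- F admits P: a linear order on V(F) (given by an injective ranking
-- r : V(F) → ℕ, x ≺ y iff r x < r y) and a colouring φ of unordered pairs
-- (a symmetric function on pairs of distinct vertices) such that every
-- edge {x,y,z} with x ≺ y ≺ z has (φ xy, φ xz, φ yz) ∈ A.
Admits : ThreeGraph → Palette → Set
Admits F P =
  Σ (Fin (n F) → ℕ) λ r → Injective _≡_ _≡_ r ×
  Σ (Fin (n F) → Fin (n F) → Fin (c P)) λ φ →
    (∀ x y → φ x y ≡ φ y x) ×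
    (∀ x y z → IsEdge F x y z → r x < r y → r y < r z →
       A P (φ x y) (φ x z) (φ y z))

-- The k-star S_k: vertex zero is u, vertex suc i is v_{i+1};
-- edges are the triples {u, v_i, v_j} with i ≠ j.
IsStarEdge : (k : ℕ) → Fin (suc k) → Fin (suc k) → Fin (suc k) → Set
IsStarEdge k x y z =
    (x ≡ zero × StarLeaves y z)
  ⊎ (y ≡ zero × StarLeaves x z)
  ⊎ (z ≡ zero × StarLeaves x y)
  where
  StarLeaves : Fin (suc k) → Fin (suc k) → Set
  StarLeaves p q = Σ (Fin k) λ i → Σ (Fin k) λ j → i ≢ j × p ≡ suc i × q ≡ suc j

Star : ℕ → ThreeGraph
Star k = record { n = suc k ; IsEdge = IsStarEdge k }

-- The digraph D on C₁ ⊎ C₂ (inj₁ a = a¹, inj₂ a = a²).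
Arc : (P : Palette) → Fin (c P) ⊎ Fin (c P) → Fin (c P) ⊎ Fin (c P) → Set
Arc P (inj₁ a) (inj₁ b) = Good23 P a b
Arc P (inj₂ a) (inj₂ b) = Good12 P a b
Arc P (inj₁ a) (inj₂ b) = Good13 P a b
Arc P (inj₂ b) (inj₁ a) = Good13 P a b

HasTransitiveTournament : (P : Palette) → ℕ → Set
HasTransitiveTournament P k =
  Σ (Fin k → Fin (c P) ⊎ Fin (c P)) λ x → Injective _≡_ _≡_ x ×
    (∀ i j → i <ᶠ j → Arc P (x i) (x j))

{-# OPTIONS --safe #-}
module Submission where

-- Given a transitive tournament x₀, …, x_{k-1} in D, order the k-star by
-- putting the leaves vᵢ with xᵢ ∈ C₁ before the centre u and those with
-- xᵢ ∈ C₂ after it, each group in index order. Colour u vᵢ by the colour of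
-- xᵢ, and vᵢ vⱼ (i < j) by the remaining colour of an admissible triple
-- witnessing the arc xᵢ → xⱼ. An edge {u, vᵢ, vⱼ} with u first, in the
-- middle or last then has both leaves in C₂, one in each copy, or both in C₁,
-- and the arc between them supplies exactly the admissible triple required.

open import Defs
open import Data.Nat using (ℕ; suc; _+_; _≤_; s≤s; s<s⁻¹) renaming (_<_ to _<ℕ_)
open import Data.Nat.Properties
  using (m≤m+n; <-trans; +-cancelˡ-<; +-cancelˡ-≡; suc-injective)
  renaming (<-asym to <ℕ-asym; <-irrefl to <ℕ-irrefl)
open import Data.Fin using (Fin; zero; suc; toℕ) renaming (_<_ to _<ᶠ_)
open import Data.Fin.Properties using (toℕ<n; toℕ-injective; <-cmp; <-asym; <-irrefl; <-irrelevant)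
open import Data.Product using (∃; _,_; proj₁; proj₂)
open import Data.Sum using (_⊎_; inj₁; inj₂; reduce)
open import Data.Empty using (⊥-elim)
open import Relation.Binary.PropositionalEquality using (_≡_; _≢_; refl; sym; cong)
open import Relation.Binary.Definitions using (tri<; tri≈; tri>)
open import Relation.Nullary using (¬_)
open import Function.Base using (case_of_)
open import Function.Definitions using (Injective)

module _ {n : ℕ} {B : Set} (f : (i j : Fin n) → i <ᶠ j → B) (d : B) where

  symmetrise : Fin n → Fin n → B
  symmetrise i j with <-cmp i j
  ... | tri< i<j _ _ = f i j i<j
  ... | tri≈ _ _ _   = d
  ... | tri> _ _ j<i = f j i j<i

  symmetrise-< : ∀ {i j} (i<j : i <ᶠ j) → symmetrise i j ≡ f i j i<j
  symmetrise-< {i} {j} i<j with <-cmp i j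
  ... | tri< i<j′ _ _ = cong (f i j) (<-irrelevant i<j′ i<j)
  ... | tri≈ i≮j _ _  = ⊥-elim (i≮j i<j)
  ... | tri> i≮j _ _  = ⊥-elim (i≮j i<j)

  symmetrise-> : ∀ {i j} (i<j : i <ᶠ j) → symmetrise j i ≡ f i j i<j
  symmetrise-> {i} {j} i<j with <-cmp j i
  ... | tri< j<i _ _  = ⊥-elim (<-asym i<j j<i)
  ... | tri≈ _ _ j≯i  = ⊥-elim (j≯i i<j)
  ... | tri> _ _ i<j′ = cong (f i j) (<-irrelevant i<j′ i<j)

  symmetrise-diagonal : ∀ i → symmetrise i i ≡ d
  symmetrise-diagonal i with <-cmp i i
  ... | tri< i<i _ _ = ⊥-elim (<-irrefl refl i<i)
  ... | tri≈ _ _ _   = refl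
  ... | tri> _ _ i<i = ⊥-elim (<-irrefl refl i<i)

  symmetrise-sym : ∀ i j → symmetrise i j ≡ symmetrise j i
  symmetrise-sym i j with <-cmp i j
  ... | tri< i<j _ _  = sym (symmetrise-> i<j)
  ... | tri≈ _ refl _ = sym (symmetrise-diagonal i)
  ... | tri> _ _ j<i  = sym (symmetrise-< j<i)

IsArcWitness : (P : Palette) (p q : Fin (c P) ⊎ Fin (c P)) → Fin (c P) → Set
IsArcWitness P (inj₁ a) (inj₁ b) w = A P w a b
IsArcWitness P (inj₂ a) (inj₂ b) w = A P a b w
IsArcWitness P (inj₁ a) (inj₂ b) w = A P a w b
IsArcWitness P (inj₂ b) (inj₁ a) w = A P a w b

arc-witness : ∀ {P} p q → Arc P p q → ∃ (IsArcWitness P p q)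
arc-witness (inj₁ _) (inj₁ _) arc = arc
arc-witness (inj₂ _) (inj₂ _) arc = arc
arc-witness (inj₁ _) (inj₂ _) arc = arc
arc-witness (inj₂ _) (inj₁ _) arc = arc

module _ {X : Set} (k : ℕ) where

  leafPosition : X ⊎ X → Fin k → ℕ
  leafPosition (inj₁ _) i = toℕ i
  leafPosition (inj₂ _) i = suc (k + toℕ i)

  leafPosition-inj₁<k : ∀ a i → leafPosition (inj₁ a) i <ℕ k
  leafPosition-inj₁<k _ i = toℕ<n i

  k<leafPosition-inj₂ : ∀ b i → k <ℕ leafPosition (inj₂ b) i
  k<leafPosition-inj₂ _ i = s≤s (m≤m+n k (toℕ i))

  leafPosition-inj₁<inj₂ : ∀ a b i j → leafPosition (inj₁ a) i <ℕ leafPosition (inj₂ b) j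
  leafPosition-inj₁<inj₂ a b i j = <-trans (leafPosition-inj₁<k a i) (k<leafPosition-inj₂ b j)

  leafPosition≢k : ∀ p i → leafPosition p i ≢ k
  leafPosition≢k (inj₁ a) i eq = <ℕ-irrefl eq (leafPosition-inj₁<k a i)
  leafPosition≢k (inj₂ b) i eq = <ℕ-irrefl (sym eq) (k<leafPosition-inj₂ b i)

  leafPosition-injective : ∀ p q {i j} → leafPosition p i ≡ leafPosition q j → i ≡ j
  leafPosition-injective (inj₁ _) (inj₁ _) eq = toℕ-injective eq
  leafPosition-injective (inj₂ _) (inj₂ _) eq =
    toℕ-injective (+-cancelˡ-≡ k _ _ (suc-injective eq))
  leafPosition-injective (inj₁ a) (inj₂ b) {i} {j} eq =
    ⊥-elim (<ℕ-irrefl eq (leafPosition-inj₁<inj₂ a b i j))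
  leafPosition-injective (inj₂ b) (inj₁ a) {i} {j} eq =
    ⊥-elim (<ℕ-irrefl (sym eq) (leafPosition-inj₁<inj₂ a b j i))

module _ {P : Palette} {k : ℕ} where

  private
    pos : Fin (c P) ⊎ Fin (c P) → Fin k → ℕ
    pos = leafPosition k

  centre-first-admissible : ∀ p q {i j w} → k <ℕ pos p i → pos p i <ℕ pos q j →
    (i <ᶠ j → IsArcWitness P p q w) → A P (reduce p) (reduce q) w
  centre-first-admissible (inj₁ a) _ {i} k<i _ _ =
    ⊥-elim (<ℕ-asym k<i (leafPosition-inj₁<k k a i))
  centre-first-admissible (inj₂ b) (inj₁ a) {i} {j} _ i<j _ =
    ⊥-elim (<ℕ-asym i<j (leafPosition-inj₁<inj₂ k a b j i))
  centre-first-admissible (inj₂ _) (inj₂ _) _ i<j witness =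
    witness (+-cancelˡ-< k _ _ (s<s⁻¹ i<j))

  centre-middle-admissible : ∀ p q {i j w} → pos p i <ℕ k → k <ℕ pos q j →
    IsArcWitness P p q w ⊎ IsArcWitness P q p w → A P (reduce p) w (reduce q)
  centre-middle-admissible (inj₂ b) _ {i} i<k _ _ =
    ⊥-elim (<ℕ-asym i<k (k<leafPosition-inj₂ k b i))
  centre-middle-admissible (inj₁ _) (inj₁ a) {j = j} _ k<j _ =
    ⊥-elim (<ℕ-asym k<j (leafPosition-inj₁<k k a j))
  centre-middle-admissible (inj₁ _) (inj₂ _) _ _ (inj₁ witness) = witness
  centre-middle-admissible (inj₁ _) (inj₂ _) _ _ (inj₂ witness) = witness

  centre-last-admissible : ∀ p q {i j w} → pos p i <ℕ pos q j → pos q j <ℕ k →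
    (i <ᶠ j → IsArcWitness P p q w) → A P w (reduce p) (reduce q)
  centre-last-admissible _ (inj₂ b) {j = j} _ j<k _ =
    ⊥-elim (<ℕ-asym j<k (k<leafPosition-inj₂ k b j))
  centre-last-admissible (inj₂ b) (inj₁ a) {i} {j} i<j _ _ =
    ⊥-elim (<ℕ-asym i<j (leafPosition-inj₁<inj₂ k a b j i))
  centre-last-admissible (inj₁ _) (inj₁ _) i<j _ witness = witness i<j

module StarFromTournament {k : ℕ} {P : Palette}
    (x : Fin k → Fin (c P) ⊎ Fin (c P))
    (arcs : ∀ i j → i <ᶠ j → Arc P (x i) (x j))
    (default : Fin (c P)) where

  arcWitness : ∀ i j → i <ᶠ j → ∃ (IsArcWitness P (x i) (x j))
  arcWitness i j i<j = arc-witness (x i) (x j) (arcs i j i<j)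

  arcColour : ∀ i j → i <ᶠ j → Fin (c P)
  arcColour i j i<j = proj₁ (arcWitness i j i<j)

  leafColour : Fin k → Fin k → Fin (c P)
  leafColour = symmetrise arcColour default

  leafColour-< : ∀ {i j} → i <ᶠ j → IsArcWitness P (x i) (x j) (leafColour i j)
  leafColour-< {i} {j} i<j rewrite symmetrise-< arcColour default i<j = proj₂ (arcWitness i j i<j)

  leafColour-> : ∀ {i j} → j <ᶠ i → IsArcWitness P (x j) (x i) (leafColour i j)
  leafColour-> {i} {j} j<i rewrite symmetrise-> arcColour default j<i = proj₂ (arcWitness j i j<i)

  leafColour-≢ : ∀ {i j} → i ≢ j →
    IsArcWitness P (x i) (x j) (leafColour i j) ⊎ IsArcWitness P (x j) (x i) (leafColour i j)
  leafColour-≢ {i} {j} i≢j = case <-cmp i j of λ where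
    (tri< i<j _ _) → inj₁ (leafColour-< i<j)
    (tri≈ _ i≡j _) → ⊥-elim (i≢j i≡j)
    (tri> _ _ j<i) → inj₂ (leafColour-> j<i)

  position : Fin (suc k) → ℕ
  position zero    = k
  position (suc i) = leafPosition k (x i) i

  position-injective : Injective _≡_ _≡_ position
  position-injective {zero}  {zero}  _  = refl
  position-injective {zero}  {suc j} eq = ⊥-elim (leafPosition≢k k (x j) j (sym eq))
  position-injective {suc i} {zero}  eq = ⊥-elim (leafPosition≢k k (x i) i eq)
  position-injective {suc i} {suc j} eq = cong suc (leafPosition-injective k (x i) (x j) eq)

  colouring : Fin (suc k) → Fin (suc k) → Fin (c P)
  colouring zero    zero    = default
  colouring zero    (suc j) = reduce (x j)
  colouring (suc i) zero    = reduce (x i)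
  colouring (suc i) (suc j) = leafColour i j

  colouring-sym : ∀ u v → colouring u v ≡ colouring v u
  colouring-sym zero    zero    = refl
  colouring-sym zero    (suc j) = refl
  colouring-sym (suc i) zero    = refl
  colouring-sym (suc i) (suc j) = symmetrise-sym arcColour default i j

  edge-admissible : ∀ u v w → IsEdge (Star k) u v w →
    position u <ℕ position v → position v <ℕ position w →
    A P (colouring u v) (colouring u w) (colouring v w)
  edge-admissible _ _ _ (inj₁ (refl , i , j , _ , refl , refl)) u<v v<w =
    centre-first-admissible (x i) (x j) u<v v<w leafColour-<
  edge-admissible _ _ _ (inj₂ (inj₁ (refl , i , j , i≢j , refl , refl))) u<v v<w =
    centre-middle-admissible (x i) (x j) u<v v<w (leafColour-≢ i≢j)
  edge-admissible _ _ _ (inj₂ (inj₂ (refl , i , j , _ , refl , refl))) u<v v<w =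
    centre-last-admissible (x i) (x j) u<v v<w leafColour-<

  star-admits : Admits (Star k) P
  star-admits = position , position-injective , colouring , colouring-sym , edge-admissible

claim2p3 : (k : ℕ) → 2 ≤ k → (P : Palette) → ¬ Admits (Star k) P →
    ¬ HasTransitiveTournament P k
claim2p3 (suc k) _ P ¬admits (x , _ , arcs) =
  ¬admits (StarFromTournament.star-admits x arcs (reduce (x zero)))
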